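{- Let $k\ge1$ be an integer and let $\mathcal{G}$ be a factorization of the countably infinite complete graph $K_{\mathbb{N}}$ into $k$-stars. Then there is at most one vertex of $K_{\mathbb{N}}$ that is not a center of any $k$-star in $\mathcal{G}$. Consequently $|\mathcal{G}|=|\mathbb{N}|$.
   Context: The countable star $S_1$ is the graph with vertex set $\mathbb{N}$ and edges $\{0,i\}$, $i\ge1$. A $k$-star $S_k$ is the vertex-disjoint union of $k$ copies of $S_1$; its centers are its $k$ vertices of infinite degree. A factorization of $K_{\mathbb{N}}$ into $k$-stars is a family of spanning subgraphs of $K_{\mathbb{N}}$, each isomorphic to $S_k$, whose edge sets partition $E(K_{\mathbb{N}})$. -}

module Defs where

open import Data.Nat using (ℕ; _≤_)
open import Data.Fin using (Fin)
open import Data.Product using (Σ; ∃; _×_; _,_)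
open import Data.Sum using (_⊎_)
open import Relation.Binary.PropositionalEquality using (_≡_; _≢_)
open import Function.Bundles using (_↔_; _⇔_; Inverse)

Graph : Set₁
Graph = ℕ → ℕ → Set

-- The k-star S_k: vertex set Fin k × ℕ (k disjoint copies of the countable
-- star S_1 on ℕ, whose centre is 0); (i,x) ~ (j,y) iff i ≡ j and
-- one of x,y is 0 and the other is ≥ 1.
StarEdge : (k : ℕ) → Fin k × ℕ → Fin k × ℕ → Set
StarEdge k (i , x) (j , y) =
  i ≡ j × ((x ≡ 0 × y ≢ 0) ⊎ (y ≡ 0 × x ≢ 0))

IsoToStar : (k : ℕ) → Graph → Set
IsoToStar k E =
  Σ ((Fin k × ℕ) ↔ ℕ) λ f →
    ∀ a b → E (Inverse.to f a) (Inverse.to f b) ⇔ StarEdge k a b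

record Factorization (k : ℕ) (I : Set) (E : I → Graph) : Set where
  field
    iso       : ∀ g → IsoToStar k (E g)
    partition : ∀ u v → u ≢ v →
                Σ I λ g → E g u v × (∀ g' → E g' u v → g' ≡ g)

-- v is a centre of the graph E: v has infinite degree.
IsCenter : Graph → ℕ → Set
IsCenter E v = ∀ n → ∃ λ m → n ≤ m × E v m

-- Every edge uv of K_ℕ lies in some star of the factorization, and in that
-- star one of u, v occupies a center position, which has infinite degree; so
-- two vertices that are centers of no star cannot be distinct.
--
-- For countability, code a star by the pair formed by the center and the
-- first leaf of its first component. The code is injective because that edge
-- lies in only one star, and its image is decidable because a star with code
-- x has such an edge among the vertices ≤ x. The image is unbounded: if B
-- exceeds every center of the finitely many stars with code below n, then the
-- edge {B + 1, B + 2} has an endpoint at a center of its star, so that star has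
-- code at least n. Counting the image from below then enumerates the stars.
module Submission where

open import Defs
open import Data.Nat using (ℕ; zero; suc; _+_; _⊔_; _≤_; _<_; _≟_; _≤?_; z≤n; s≤s; _≤′_; ≤′-refl; ≤′-step)
open import Data.Nat.Properties
open import Data.Fin as Fin using (Fin; toℕ; fromℕ<)
open import Data.Fin.Properties using (any?; toℕ-injective; toℕ-fromℕ<; <⇒notInjective)
open import Data.Product using (Σ; ∃; _×_; _,_; proj₁; proj₂)
open import Data.Sum using (_⊎_; inj₁; inj₂)
open import Data.Empty using (⊥-elim)
open import Function using (_∘_)
open import Function.Bundles using (_↔_; Inverse; Equivalence; Injection; mk↔ₛ′)
open import Function.Definitions using (Injective)
open import Function.Properties.Inverse using (↔⇒↣)
open import Relation.Binary using (tri<; tri≈; tri>)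
open import Relation.Binary.PropositionalEquality
open import Relation.Nullary using (¬_; Dec; yes; no; contradiction)
open import Relation.Nullary.Decidable using (map′)
open import Relation.Unary using (Decidable)

triangle : ℕ → ℕ
triangle zero    = zero
triangle (suc n) = triangle n + suc n

pair : ℕ → ℕ → ℕ
pair a b = triangle (a + b) + b

n≤triangle : ∀ n → n ≤ triangle n
n≤triangle zero    = z≤n
n≤triangle (suc n) = m≤n+m (suc n) (triangle n)

triangle+offset< : ∀ {s s′ b} → b ≤ s → s < s′ → triangle s + b < triangle s′
triangle+offset< {s} {suc t} b≤s s<1+t with m<1+n⇒m<n∨m≡n s<1+t
... | inj₁ s<t    = <-≤-trans (triangle+offset< b≤s s<t) (m≤m+n (triangle t) (suc t))
... | inj₂ refl   = +-monoʳ-< (triangle s) (s≤s b≤s)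

triangle+offset-injective : ∀ {s s′ b b′} → b ≤ s → b′ ≤ s′ →
                            triangle s + b ≡ triangle s′ + b′ → s ≡ s′
triangle+offset-injective {s} {s′} b≤s b′≤s′ eq with <-cmp s s′
... | tri< s<s′ _ _ = contradiction eq (<⇒≢ (<-≤-trans (triangle+offset< b≤s s<s′) (m≤m+n _ _)))
... | tri≈ _ s≡s′ _ = s≡s′
... | tri> _ _ s′<s = contradiction (sym eq) (<⇒≢ (<-≤-trans (triangle+offset< b′≤s′ s′<s) (m≤m+n _ _)))

pair-injective : ∀ {a b a′ b′} → pair a b ≡ pair a′ b′ → a ≡ a′ × b ≡ b′
pair-injective {a} {b} {a′} {b′} eq = a≡a′ , b≡b′
  where
  sum≡ : a + b ≡ a′ + b′
  sum≡ = triangle+offset-injective (m≤n+m b a) (m≤n+m b′ a′) eq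
  b≡b′ : b ≡ b′
  b≡b′ = +-cancelˡ-≡ (triangle (a + b)) b b′ (trans eq (cong (λ s → triangle s + b′) (sym sum≡)))
  a≡a′ : a ≡ a′
  a≡a′ = +-cancelʳ-≡ b a a′ (trans sum≡ (cong (a′ +_) (sym b≡b′)))

pair-≥ˡ : ∀ a b → a ≤ pair a b
pair-≥ˡ a b = ≤-trans (m≤m+n a b) (≤-trans (n≤triangle (a + b)) (m≤m+n _ b))

pair-≥ʳ : ∀ a b → b ≤ pair a b
pair-≥ʳ a b = m≤n+m b (triangle (a + b))

module _ {P : ℕ → Set} (P? : Decidable P) where

  count : ℕ → ℕ
  count zero = zero
  count (suc n) with P? n
  ... | yes _ = suc (count n)
  ... | no  _ = count n

  count-suc : ∀ {n} → P n → count (suc n) ≡ suc (count n)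
  count-suc {n} p with P? n
  ... | yes _ = refl
  ... | no ¬p = contradiction p ¬p

  count-≤-suc : ∀ n → count n ≤ count (suc n)
  count-≤-suc n with P? n
  ... | yes _ = n≤1+n (count n)
  ... | no  _ = ≤-refl

  count-mono : ∀ {m n} → m ≤ n → count m ≤ count n
  count-mono = go ∘ ≤⇒≤′
    where
    go : ∀ {m n} → m ≤′ n → count m ≤ count n
    go ≤′-refl        = ≤-refl
    go (≤′-step m≤′n) = ≤-trans (go m≤′n) (count-≤-suc _)

  count-< : ∀ {m n} → P m → m < n → count m < count n
  count-< {n = n} p m<n = subst (_≤ count n) (count-suc p) (count-mono m<n)

  count-injective : ∀ {m n} → P m → P n → count m ≡ count n → m ≡ n
  count-injective {m} {n} pm pn eq with <-cmp m n
  ... | tri< m<n _ _ = contradiction eq (<⇒≢ (count-< pm m<n))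
  ... | tri≈ _ m≡n _ = m≡n
  ... | tri> _ _ n<m = contradiction (sym eq) (<⇒≢ (count-< pn n<m))

  -- count grows in steps of at most one, so it attains every value below count b.
  count-hit : ∀ {n} b → n < count b → ∃ λ x → P x × count x ≡ n
  count-hit (suc b) n<count with P? b
  ... | no _ = count-hit b n<count
  ... | yes p with m<1+n⇒m<n∨m≡n n<count
  ...   | inj₁ n<count-b = count-hit b n<count-b
  ...   | inj₂ n≡count-b = b , p , sym n≡count-b

  count-unbounded : (∀ n → ∃ λ x → n ≤ x × P x) → ∀ n → ∃ λ b → n ≤ count b
  count-unbounded unbounded zero    = zero , z≤n
  count-unbounded unbounded (suc n) =
    let (b , n≤count-b) = count-unbounded unbounded n
        (x , b≤x , p)   = unbounded b
    in suc x , subst (suc n ≤_) (sym (count-suc p)) (s≤s (≤-trans n≤count-b (count-mono b≤x)))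

↔ℕ-viaUnboundedInjection : {I : Set} (φ : I → ℕ) → Injective _≡_ _≡_ φ →
                           Decidable (λ x → ∃ λ i → φ i ≡ x) →
                           (∀ n → ∃ λ i → n ≤ φ i) → I ↔ ℕ
↔ℕ-viaUnboundedInjection {I} φ φ-injective image? unbounded =
  mk↔ₛ′ rank unrank rank∘unrank unrank∘rank
  where
  rank : I → ℕ
  rank i = count image? (φ i)

  image-unbounded : ∀ m → ∃ λ x → m ≤ x × ∃ λ i → φ i ≡ x
  image-unbounded m = let (i , m≤φi) = unbounded m in φ i , m≤φi , i , refl

  hit : ∀ n → ∃ λ x → (∃ λ i → φ i ≡ x) × count image? x ≡ n
  hit n = count-hit image? _ (proj₂ (count-unbounded image? image-unbounded (suc n)))

  unrank : ℕ → I
  unrank n = proj₁ (proj₁ (proj₂ (hit n)))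

  rank∘unrank : ∀ n → rank (unrank n) ≡ n
  rank∘unrank n = let (_ , (_ , φi≡x) , count≡n) = hit n
                  in trans (cong (count image?) φi≡x) count≡n

  unrank∘rank : ∀ i → unrank (rank i) ≡ i
  unrank∘rank i = let (_ , (j , φj≡x) , count≡) = hit (rank i)
                  in φ-injective (trans φj≡x (count-injective image? (j , φj≡x) (i , refl) count≡))

upperBound-Fin : ∀ {n} (f : Fin n → ℕ) → ∃ λ B → ∀ i → f i ≤ B
upperBound-Fin {zero}  f = zero , λ ()
upperBound-Fin {suc n} f =
  let (B , f∘suc≤B) = upperBound-Fin (f ∘ Fin.suc)
  in f Fin.zero ⊔ B , λ { Fin.zero → m≤m⊔n _ B ; (Fin.suc i) → ≤-trans (f∘suc≤B i) (m≤n⊔m _ B) }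

upperBound-< : (f : ℕ → ℕ) (n : ℕ) → ∃ λ B → ∀ {x} → x < n → f x ≤ B
upperBound-< f n =
  let (B , bounded) = upperBound-Fin (f ∘ toℕ {n})
  in B , λ x<n → subst (λ y → f y ≤ B) (toℕ-fromℕ< x<n) (bounded (fromℕ< x<n))

injective⇒unbounded : (h : ℕ → ℕ) → Injective _≡_ _≡_ h → ∀ n → ∃ λ y → n ≤ h y
injective⇒unbounded h h-injective n with any? (λ (j : Fin (suc n)) → n ≤? h (toℕ j))
... | yes (j , n≤hj) = toℕ j , n≤hj
... | no ∄ = ⊥-elim (<⇒notInjective (n<1+n n) squeeze-injective)
  where
  h<n : ∀ j → h (toℕ j) < n
  h<n j = ≰⇒> (λ n≤hj → ∄ (j , n≤hj))
  squeeze : Fin (suc n) → Fin n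
  squeeze j = fromℕ< (h<n j)
  squeeze-injective : Injective _≡_ _≡_ squeeze
  squeeze-injective {i} {j} eq = toℕ-injective (h-injective (begin
    h (toℕ i)              ≡⟨ toℕ-fromℕ< (h<n i) ⟨
    toℕ (squeeze i)        ≡⟨ cong toℕ eq ⟩
    toℕ (squeeze j)        ≡⟨ toℕ-fromℕ< (h<n j) ⟩
    h (toℕ j)              ∎))
    where open ≡-Reasoning

module Stars {k : ℕ} {I : Set} {E : I → Graph} (factorization : Factorization k I E) where
  open Factorization factorization

  embedding : I → (Fin k × ℕ) ↔ ℕ
  embedding g = proj₁ (iso g)

  vertex : I → Fin k × ℕ → ℕ
  vertex g = Inverse.to (embedding g)

  position : I → ℕ → Fin k × ℕ
  position g = Inverse.from (embedding g)

  vertex∘position : ∀ g v → vertex g (position g v) ≡ v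
  vertex∘position g = Inverse.strictlyInverseˡ (embedding g)

  vertex-injective : ∀ g → Injective _≡_ _≡_ (vertex g)
  vertex-injective g = Injection.injective (↔⇒↣ (embedding g))

  starEdge⇒edge : ∀ g {a b} → StarEdge k a b → E g (vertex g a) (vertex g b)
  starEdge⇒edge g {a} {b} = Equivalence.from (proj₂ (iso g) a b)

  edge⇒starEdge : ∀ g {u v} → E g u v → StarEdge k (position g u) (position g v)
  edge⇒starEdge g {u} {v} e = Equivalence.to (proj₂ (iso g) (position g u) (position g v))
    (subst₂ (E g) (sym (vertex∘position g u)) (sym (vertex∘position g v)) e)

  AtCenter : I → ℕ → Set
  AtCenter g v = proj₂ (position g v) ≡ 0

  atCenter⇒vertex : ∀ g {v} → AtCenter g v → vertex g (proj₁ (position g v) , 0) ≡ v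
  atCenter⇒vertex g {v} v-center =
    trans (cong (λ y → vertex g (proj₁ (position g v) , y)) (sym v-center)) (vertex∘position g v)

  edge⇒atCenter : ∀ g {u v} → E g u v → AtCenter g u ⊎ AtCenter g v
  edge⇒atCenter g e with edge⇒starEdge g e
  ... | _ , inj₁ (u-center , _) = inj₁ u-center
  ... | _ , inj₂ (v-center , _) = inj₂ v-center

  atCenter⇒isCenter : ∀ g {v} → AtCenter g v → IsCenter (E g) v
  atCenter⇒isCenter g {v} v-center n =
    let (y , n≤) = injective⇒unbounded leaf leaf-injective n
    in leaf y , n≤ , subst (λ c → E g c (leaf y)) (atCenter⇒vertex g v-center)
                          (starEdge⇒edge g (refl , inj₁ (refl , λ ())))
    where
    leaf : ℕ → ℕ
    leaf y = vertex g (proj₁ (position g v) , suc y)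
    leaf-injective : Injective _≡_ _≡_ leaf
    leaf-injective eq = suc-injective (cong proj₂ (vertex-injective g eq))

  starOf : ∀ {u v} → u ≢ v → I
  starOf u≢v = proj₁ (partition _ _ u≢v)

  starOf-edge : ∀ {u v} (u≢v : u ≢ v) → E (starOf u≢v) u v
  starOf-edge u≢v = proj₁ (proj₂ (partition _ _ u≢v))

  starOf-unique : ∀ {g u v} (u≢v : u ≢ v) → E g u v → g ≡ starOf u≢v
  starOf-unique u≢v e = proj₂ (proj₂ (partition _ _ u≢v)) _ e

  nonCenter-unique : ∀ u v → ¬ Σ I (λ g → IsCenter (E g) u) → ¬ Σ I (λ g → IsCenter (E g) v) →
                     u ≡ v
  nonCenter-unique u v u-nonCenter v-nonCenter with u ≟ v
  ... | yes u≡v = u≡v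
  ... | no u≢v with edge⇒atCenter (starOf u≢v) (starOf-edge u≢v)
  ...   | inj₁ u-center = contradiction (starOf u≢v , atCenter⇒isCenter _ u-center) u-nonCenter
  ...   | inj₂ v-center = contradiction (starOf u≢v , atCenter⇒isCenter _ v-center) v-nonCenter

module Coding {k : ℕ} {I : Set} {E : I → Graph} (factorization : Factorization (suc k) I E) where
  open Stars factorization

  root leaf : I → ℕ
  root g = vertex g (Fin.zero , 0)
  leaf g = vertex g (Fin.zero , 1)

  root≢leaf : ∀ g → root g ≢ leaf g
  root≢leaf g eq = 0≢1+n (cong proj₂ (vertex-injective g eq))

  root-leaf-edge : ∀ g → E g (root g) (leaf g)
  root-leaf-edge g = starEdge⇒edge g (refl , inj₁ (refl , λ ()))

  starOf-root-leaf : ∀ g → starOf (root≢leaf g) ≡ g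
  starOf-root-leaf g = sym (starOf-unique (root≢leaf g) (root-leaf-edge g))

  code : I → ℕ
  code g = pair (root g) (leaf g)

  code-injective : Injective _≡_ _≡_ code
  code-injective {g} {g′} eq =
    let (root≡ , leaf≡) = pair-injective eq
    in trans (sym (starOf-root-leaf g))
             (sym (starOf-unique (root≢leaf g)
                                 (subst₂ (E g′) (sym root≡) (sym leaf≡) (root-leaf-edge g′))))

  EdgeWithCode : ℕ → ℕ → ℕ → Set
  EdgeWithCode x a b = Σ (a ≢ b) λ a≢b → code (starOf a≢b) ≡ x

  edgeWithCode? : ∀ x a b → Dec (EdgeWithCode x a b)
  edgeWithCode? x a b with a ≟ b
  ... | yes a≡b = no λ (a≢b , _) → a≢b a≡b
  ... | no a≢b  = map′ (a≢b ,_)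
                       (λ (a≢b′ , eq) → trans (cong code (starOf-unique a≢b (starOf-edge a≢b′))) eq)
                       (code (starOf a≢b) ≟ x)

  code-image? : Decidable (λ x → ∃ λ g → code g ≡ x)
  code-image? x = map′ edge⇒image image⇒edge
    (anyUpTo? (λ a → anyUpTo? (edgeWithCode? x a) (suc x)) (suc x))
    where
    edge⇒image : (∃ λ a → a < suc x × ∃ λ b → b < suc x × EdgeWithCode x a b) → ∃ λ g → code g ≡ x
    edge⇒image (_ , _ , _ , _ , a≢b , eq) = starOf a≢b , eq
    image⇒edge : (∃ λ g → code g ≡ x) → ∃ λ a → a < suc x × ∃ λ b → b < suc x × EdgeWithCode x a b
    image⇒edge (g , refl) = root g , s≤s (pair-≥ˡ (root g) (leaf g)) ,
                            leaf g , s≤s (pair-≥ʳ (root g) (leaf g)) ,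
                            root≢leaf g , cong code (starOf-root-leaf g)

  centers-bounded : ∀ n → ∃ λ B → ∀ {g v} → code g < n → AtCenter g v → v ≤ B
  centers-bounded n =
    let (B , bounded) = upperBound-< (λ x → centerBoundOfCode x (code-image? x)) n
    in B , λ {g} {v} code<n v-center → begin
         v                                                   ≡⟨ atCenter⇒vertex g v-center ⟨
         vertex g (proj₁ (position g v) , 0)                 ≤⟨ proj₂ (centerBound g) _ ⟩
         proj₁ (centerBound g)                               ≡⟨ centerBoundOfCode-code g (code-image? (code g)) ⟨
         centerBoundOfCode (code g) (code-image? (code g))   ≤⟨ bounded code<n ⟩
         B                                                   ∎
    where
    open ≤-Reasoning
    centerBound : ∀ g → ∃ λ B → ∀ i → vertex g (i , 0) ≤ B
    centerBound g = upperBound-Fin (λ i → vertex g (i , 0))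
    centerBoundOfCode : ∀ x → Dec (∃ λ g → code g ≡ x) → ℕ
    centerBoundOfCode _ (yes (g , _)) = proj₁ (centerBound g)
    centerBoundOfCode _ (no _)        = 0
    centerBoundOfCode-code : ∀ g d → centerBoundOfCode (code g) d ≡ proj₁ (centerBound g)
    centerBoundOfCode-code g (yes (g′ , eq)) = cong (proj₁ ∘ centerBound) (code-injective eq)
    centerBoundOfCode-code g (no ∄)          = contradiction (g , refl) ∄

  code-unbounded : ∀ n → ∃ λ g → n ≤ code g
  code-unbounded n = starOf v≢w , ≮⇒≥ code≮n
    where
    B v w : ℕ
    B = proj₁ (centers-bounded n)
    v = suc B
    w = suc v
    v≢w : v ≢ w
    v≢w = 1+n≢n ∘ sym
    code≮n : ¬ code (starOf v≢w) < n
    code≮n code<n with edge⇒atCenter (starOf v≢w) (starOf-edge v≢w)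
    ... | inj₁ v-center = <⇒≱ (n<1+n B) (proj₂ (centers-bounded n) code<n v-center)
    ... | inj₂ w-center = <⇒≱ (m<n⇒m<1+n (n<1+n B)) (proj₂ (centers-bounded n) code<n w-center)

  stars↔ℕ : I ↔ ℕ
  stars↔ℕ = ↔ℕ-viaUnboundedInjection code code-injective code-image? code-unbounded

lemma4p3 : (k : ℕ) → 1 ≤ k → (I : Set) (E : I → Graph) → Factorization k I E →
    (∀ u v → ¬ Σ I (λ g → IsCenter (E g) u) → ¬ Σ I (λ g → IsCenter (E g) v) → u ≡ v)
    × (I ↔ ℕ)
lemma4p3 (suc k) _ I E factorization = Stars.nonCenter-unique factorization , Coding.stars↔ℕ factorization
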